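{- Assume the univalence axiom. Then for small bipointed types $A,B:\mathsf{Bip}$, the canonical function $\mathsf{ext}^{\mathsf{Bip}}_{A,B}:\mathsf{Id}_{\mathsf{Bip}}(A,B)\to\mathsf{BipEquiv}(A,B)$ (defined by $\mathsf{Id}$-elimination, sending the reflexivity path on $A$ to the identity bipointed equivalence on $A$) is an equivalence of types.
   Context: Work in the intensional Martin-Löf type theory $\mathcal{H}$ with $\Sigma$-types, $\Pi$-types (with judgemental $\eta$), identity types and a universe $\mathsf{U}$ (à la Russell) closed under $\Sigma,\Pi,\mathsf{Id}$, plus function extensionality; no UIP. $\mathsf{iscontr}(X):=(\Sigma x:X)(\Pi y:X)\mathsf{Id}(x,y)$; $\mathsf{hfiber}(f,y):=(\Sigma x)\mathsf{Id}(fx,y)$; $\mathsf{isequiv}(f):=(\Pi y)\mathsf{iscontr}(\mathsf{hfiber}(f,y))$; $\mathsf{Equiv}(X,Y):=(\Sigma f:X\to Y)\mathsf{isequiv}(f)$. Univalence: for all $X,Y:\mathsf{U}$ the canonical map $\mathsf{Id}_{\mathsf{U}}(X,Y)\to\mathsf{Equiv}(X,Y)$ is an equivalence. $\mathsf{Bip}:=(\Sigma A:\mathsf{U})(A\times A)$, elements written $(A,a_0,a_1)$. $\mathsf{Bip}(A,B):=(\Sigma f:A\to B)(\mathsf{Id}(fa_0,b_0)\times\mathsf{Id}(fa_1,b_1))$. Composite of $(f,\bar f_0,\bar f_1):A\to B$ and $(g,\bar g_0,\bar g_1):B\to C$ is $(g\circ f,\ \bar g_0\cdot(g\circ\bar f_0),\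 \bar g_1\cdot(g\circ\bar f_1))$, where $g\circ p$ is the action of $g$ on a path $p$ and $q\cdot p$ is $p$ followed by $q$; identity is $(1_A,\mathsf{refl}(a_0),\mathsf{refl}(a_1))$. $\mathsf{isbipequiv}(f):=(\Sigma g:\mathsf{Bip}(B,A))\mathsf{Id}_{\mathsf{Bip}(A,A)}(gf,1_A)\times(\Sigma h:\mathsf{Bip}(B,A))\mathsf{Id}_{\mathsf{Bip}(B,B)}(fh,1_B)$; $\mathsf{BipEquiv}(A,B):=(\Sigma f:\mathsf{Bip}(A,B))\mathsf{isbipequiv}(f)$. -}

{-# OPTIONS --without-K #-}
module Defs where

open import Agda.Primitive using (Level; lzero; lsuc; _⊔_)
open import Data.Product using (Σ; _×_; _,_; proj₁; proj₂)
open import Relation.Binary.PropositionalEquality using (_≡_; refl)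

U : Set₁
U = Set

Id : ∀ {ℓ} {X : Set ℓ} → X → X → Set ℓ
Id x y = x ≡ y

ap : ∀ {ℓ ℓ'} {X : Set ℓ} {Y : Set ℓ'} (f : X → Y) {x y : X} → Id x y → Id (f x) (f y)
ap f refl = refl

-- q · p  is  p followed by q
_·_ : ∀ {ℓ} {X : Set ℓ} {x y z : X} → Id y z → Id x y → Id x z
q · refl = q

iscontr : ∀ {ℓ} → Set ℓ → Set ℓ
iscontr X = Σ X (λ x → (y : X) → Id x y)

hfiber : ∀ {ℓ ℓ'} {X : Set ℓ} {Y : Set ℓ'} → (X → Y) → Y → Set (ℓ ⊔ ℓ')
hfiber {X = X} f y = Σ X (λ x → Id (f x) y)

isequiv : ∀ {ℓ ℓ'} {X : Set ℓ} {Y : Set ℓ'} → (X → Y) → Set (ℓ ⊔ ℓ')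
isequiv {Y = Y} f = (y : Y) → iscontr (hfiber f y)

Equiv : ∀ {ℓ ℓ'} → Set ℓ → Set ℓ' → Set (ℓ ⊔ ℓ')
Equiv X Y = Σ (X → Y) isequiv

happly : ∀ {ℓ ℓ'} {X : Set ℓ} {P : X → Set ℓ'} {f g : (x : X) → P x}
       → Id f g → (x : X) → Id (f x) (g x)
happly refl x = refl

FunExt : Set₁
FunExt = {X : U} {P : X → U} (f g : (x : X) → P x) → isequiv (happly {f = f} {g = g})

id-isequiv : ∀ {ℓ} (X : Set ℓ) → isequiv (λ (x : X) → x)
id-isequiv X y = (y , refl) , λ { (x , refl) → refl }

idtoeqv : {X Y : U} → Id X Y → Equiv X Y
idtoeqv {X} refl = (λ x → x) , id-isequiv X

Univalence : Set₁
Univalence = (X Y : U) → isequiv (idtoeqv {X} {Y})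

Bip : Set₁
Bip = Σ U (λ A → A × A)

BipHom : Bip → Bip → Set
BipHom (A , a₀ , a₁) (B , b₀ , b₁) = Σ (A → B) (λ f → Id (f a₀) b₀ × Id (f a₁) b₁)

_∘B_ : {A B C : Bip} → BipHom B C → BipHom A B → BipHom A C
(g , g₀ , g₁) ∘B (f , f₀ , f₁) = (λ x → g (f x)) , (g₀ · ap g f₀) , (g₁ · ap g f₁)

idB : (A : Bip) → BipHom A A
idB (A , a₀ , a₁) = (λ x → x) , refl , refl

isbipequiv : {A B : Bip} → BipHom A B → Set
isbipequiv {A} {B} f =
  Σ (BipHom B A) (λ g → Id (_∘B_ {A} {B} {A} g f) (idB A)) ×
  Σ (BipHom B A) (λ h → Id (_∘B_ {B} {A} {B} f h) (idB B))

BipEquiv : Bip → Bip → Set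
BipEquiv A B = Σ (BipHom A B) (isbipequiv {A} {B})

idBipEquiv : (A : Bip) → BipEquiv A A
idBipEquiv A = idB A , (idB A , refl) , (idB A , refl)

extBip : (A B : Bip) → Id A B → BipEquiv A B
extBip A .A refl = idBipEquiv A

{-# OPTIONS --without-K #-}
-- By the fundamental theorem of identity types it suffices that the total
-- space Σ B, BipEquiv A B is contractible. Every bipointed equivalence has
-- an underlying equivalence of types, so this total space is a retract of
-- the type of (B, bipointed map with underlying equivalence, proof that it
-- is a bipointed equivalence). By univalence the pairs (B, equivalence)
-- form a contractible type, and so do the choices of basepoints with their
-- paths; over the resulting contractible type it remains to see that
-- being a bipointed equivalence is contractible at the identity, where
-- both conditions become fibres of (maps homotopic to) the identity.
module Submission where

open import Defs
open import Agda.Primitive using (Level; _⊔_)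
open import Data.Product using (Σ; _×_; _,_; proj₁; proj₂)
open import Relation.Binary.PropositionalEquality using (_≡_; refl; sym; trans; cong; cong₂; subst)
open import Relation.Binary.PropositionalEquality.Properties using (trans-symˡ)

private
  variable
    a b c : Level
    X Y Z : Set a

_◁_ : Set a → Set b → Set (a ⊔ b)
X ◁ Y = Σ (Y → X) λ r → Σ (X → Y) λ s → (x : X) → r (s x) ≡ x

◁-trans : X ◁ Y → Y ◁ Z → X ◁ Z
◁-trans (r , s , rs) (r′ , s′ , rs′) =
  (λ z → r (r′ z)) , (λ x → s′ (s x)) , λ x → trans (cong r (rs′ (s x))) (rs x)

◁-iscontr : X ◁ Y → iscontr Y → iscontr X
◁-iscontr (r , s , rs) (c , h) = r c , λ x → trans (cong r (h (s x))) (rs x)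

singleton-iscontr : (x : X) → iscontr (Σ X (x ≡_))
singleton-iscontr x = (x , refl) , λ { (y , refl) → refl }

Σ-iscontr : {P : X → Set b} → iscontr X → ((x : X) → iscontr (P x)) → iscontr (Σ X P)
Σ-iscontr {X = X} {P = P} (c , h) pc = (c , proj₁ (pc c)) , λ (x , p) → from-centre x (h x) p
  where
  from-centre : (x : X) → c ≡ x → (p : P x) → (c , proj₁ (pc c)) ≡ (x , p)
  from-centre .c refl p = cong (c ,_) (proj₂ (pc c) p)

×-iscontr : iscontr X → iscontr Y → iscontr (X × Y)
×-iscontr cx cy = Σ-iscontr cx (λ _ → cy)

≡-iscontr : iscontr X → (x y : X) → iscontr (x ≡ y)
≡-iscontr {X = X} (c , h) x y = trans (sym (h x)) (h y) , canonical y
  where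
  canonical : (y : X) (p : x ≡ y) → trans (sym (h x)) (h y) ≡ p
  canonical .x refl = trans-symˡ (h x)

iscontr-subst : (P : X → Set b) → iscontr X → {x y : X} → P x → P y
iscontr-subst P (c , h) {x} {y} = subst P (trans (sym (h x)) (h y))

total-iscontr⇒isequiv : {P : X → Set b} {Q : X → Set c} (f : (x : X) → P x → Q x) →
                        iscontr (Σ X P) → iscontr (Σ X Q) → (x : X) → isequiv (f x)
total-iscontr⇒isequiv {X = X} {P = P} {Q = Q} f cP cQ x q =
  ◁-iscontr (fibre-retract x q) (Σ-iscontr cP (λ w → ≡-iscontr cQ (total w) (x , q)))
  where
  total : Σ X P → Σ X Q
  total (x , p) = x , f x p
  fibre-retract : (x : X) (q : Q x) → hfiber (f x) q ◁ hfiber total (x , q)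
  fibre-retract x q = r , s , rs
    where
    r : {q : Q x} → hfiber total (x , q) → hfiber (f x) q
    r ((.x , p) , refl) = p , refl
    s : hfiber (f x) q → hfiber total (x , q)
    s (p , e) = (x , p) , cong (x ,_) e
    rs : (y : hfiber (f x) q) → r (s y) ≡ y
    rs (p , refl) = refl

Σ-≡-subst : (P : X → Set b) {x y : X} (e : x ≡ y) (p : P y) →
            _≡_ {A = Σ X P} (x , subst P (sym e) p) (y , p)
Σ-≡-subst P refl p = refl

trans-sym-cancelˡ : {x y z : X} (e : x ≡ y) (p : x ≡ z) → trans e (trans (sym e) p) ≡ p
trans-sym-cancelˡ refl refl = refl

-- The fibre is reached in two retractions, the first using only η and the
-- second only ε, so no coherence between η and ε is needed.
invertible⇒isequiv : (f : X → Y) (g : Y → X) →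
                     ((x : X) → g (f x) ≡ x) → ((y : Y) → f (g y) ≡ y) → isequiv f
invertible⇒isequiv {X = X} {Y = Y} f g η ε y₀ =
  ◁-iscontr (◁-trans via-η via-ε) (id-isequiv Y y₀)
  where
  via-η : hfiber f y₀ ◁ Σ Y (λ y → f (g y) ≡ y₀)
  via-η = (λ (y , p) → g y , p)
        , (λ (x , p) → f x , subst (λ x′ → f x′ ≡ y₀) (sym (η x)) p)
        , (λ (x , p) → Σ-≡-subst (λ x′ → f x′ ≡ y₀) (η x) p)
  via-ε : Σ Y (λ y → f (g y) ≡ y₀) ◁ Σ Y (λ y → y ≡ y₀)
  via-ε = (λ (y , q) → y , trans (ε y) q)
        , (λ (y , p) → y , trans (sym (ε y)) p)
        , (λ (y , p) → cong (y ,_) (trans-sym-cancelˡ (ε y) p))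

biinvertible⇒isequiv : (f : X → Y) (g h : Y → X) →
                       ((x : X) → g (f x) ≡ x) → ((y : Y) → f (h y) ≡ y) → isequiv f
biinvertible⇒isequiv f g h η ε = invertible⇒isequiv f g η ε′
  where
  ε′ : ∀ y → f (g y) ≡ y
  ε′ y = trans (cong (λ z → f (g z)) (sym (ε y))) (trans (cong f (η (h y))) (ε y))

funext : FunExt → {X : U} {P : X → U} {f g : (x : X) → P x} → ((x : X) → f x ≡ g x) → f ≡ g
funext fe {f = f} {g} H = proj₁ (proj₁ (fe f g H))

homotopic-isequiv : FunExt → {X Y : U} {f g : X → Y} →
                    ((x : X) → f x ≡ g x) → isequiv f → isequiv g
homotopic-isequiv fe H = subst isequiv (funext fe H)

Equiv-total-iscontr : Univalence → (A : U) → iscontr (Σ U (Equiv A))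
Equiv-total-iscontr ua A = ◁-iscontr (r , s , rs) (singleton-iscontr A)
  where
  r : Σ U (A ≡_) → Σ U (Equiv A)
  r (B , p) = B , idtoeqv p
  s : Σ U (Equiv A) → Σ U (A ≡_)
  s (B , e) = B , proj₁ (proj₁ (ua A B e))
  rs : (x : Σ U (Equiv A)) → r (s x) ≡ x
  rs (B , e) = cong (B ,_) (proj₂ (proj₁ (ua A B e)))

BipHomEquiv : Bip → Bip → Set
BipHomEquiv A B = Σ (BipHom A B) (λ f → isequiv (proj₁ f))

BipHomEquiv-total-iscontr : Univalence → (A : Bip) → iscontr (Σ Bip (BipHomEquiv A))
BipHomEquiv-total-iscontr ua (A , a₀ , a₁) =
  ◁-iscontr (r , s , λ _ → refl)
    (Σ-iscontr (Equiv-total-iscontr ua A)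
               (λ (B , f , _) → ×-iscontr (singleton-iscontr (f a₀)) (singleton-iscontr (f a₁))))
  where
  Points : Σ U (Equiv A) → Set
  Points (B , f , _) = Σ B (f a₀ ≡_) × Σ B (f a₁ ≡_)
  r : Σ (Σ U (Equiv A)) Points → Σ Bip (BipHomEquiv (A , a₀ , a₁))
  r ((B , f , e) , (b₀ , p₀) , (b₁ , p₁)) = (B , b₀ , b₁) , (f , p₀ , p₁) , e
  s : Σ Bip (BipHomEquiv (A , a₀ , a₁)) → Σ (Σ U (Equiv A)) Points
  s ((B , b₀ , b₁) , (f , p₀ , p₁) , e) = (B , f , e) , (b₀ , p₀) , (b₁ , p₁)

∘B-identityˡ : (A B : Bip) (h : BipHom A B) → _∘B_ {A} {B} {B} (idB B) h ≡ h
∘B-identityˡ A B (h , h₀ , h₁) = cong (h ,_) (cong₂ _,_ (refl·ap-id h₀) (refl·ap-id h₁))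
  where
  refl·ap-id : {X : U} {x y : X} (p : x ≡ y) → (refl · ap (λ z → z) p) ≡ p
  refl·ap-id refl = refl

bipequiv⇒isequiv : (A B : Bip) (f : BipHom A B) → isbipequiv {A} {B} f → isequiv (proj₁ f)
bipequiv⇒isequiv A B (f , _) ((g , gf) , (h , fh)) =
  biinvertible⇒isequiv f (proj₁ g) (proj₁ h) (happly (cong proj₁ gf)) (happly (cong proj₁ fh))

-- g ∘B idB A reduces to g, so the first factor is a fibre of the identity.
isbipequiv-idB-iscontr : FunExt → (A : Bip) → iscontr (isbipequiv {A} {A} (idB A))
isbipequiv-idB-iscontr fe A =
  ×-iscontr (id-isequiv (BipHom A A) (idB A))
            (homotopic-isequiv fe (λ h → sym (∘B-identityˡ A A h)) (id-isequiv (BipHom A A)) (idB A))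

BipEquiv-total-iscontr : FunExt → Univalence → (A : Bip) → iscontr (Σ Bip (BipEquiv A))
BipEquiv-total-iscontr fe ua A =
  ◁-iscontr (r , s , λ _ → refl)
    (Σ-iscontr (BipHomEquiv-total-iscontr ua A) IsBipEquiv-iscontr)
  where
  IsBipEquiv : Σ Bip (BipHomEquiv A) → Set
  IsBipEquiv (B , f , _) = isbipequiv {A} {B} f
  IsBipEquiv-iscontr : (t : Σ Bip (BipHomEquiv A)) → iscontr (IsBipEquiv t)
  IsBipEquiv-iscontr t =
    iscontr-subst (λ t → iscontr (IsBipEquiv t)) (BipHomEquiv-total-iscontr ua A)
                  {x = A , idB A , id-isequiv (proj₁ A)} {y = t} (isbipequiv-idB-iscontr fe A)
  r : Σ (Σ Bip (BipHomEquiv A)) IsBipEquiv → Σ Bip (BipEquiv A)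
  r ((B , f , _) , bi) = B , f , bi
  s : Σ Bip (BipEquiv A) → Σ (Σ Bip (BipHomEquiv A)) IsBipEquiv
  s (B , f , bi) = (B , f , bipequiv⇒isequiv A B f bi) , bi

theorem3p14 : FunExt → Univalence → (A B : Bip) → isequiv (extBip A B)
theorem3p14 fe ua A =
  total-iscontr⇒isequiv (extBip A) (singleton-iscontr A) (BipEquiv-total-iscontr fe ua A)
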